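{- Let $\mu=(\mu_0,\mu_1,\dotsc,\mu_\ell)$ be an integer partition ($\mu_0\geq\mu_1\geq\cdots\geq\mu_\ell\geq 1$), and let $n\geq 0$ and $1\leq d\leq\mu_0$. Then there is a bijection between the set $\mathcal{A}_\mu(d,n)$ of anchor words for $\mu$ and the set $\mathcal{T}_\mu(d,n)$ of tilings of the board with $\mu_0+d-1$ rows and $n$ columns by unit squares and translates of the Ferrers tile of $\mu$.
   Context: The Ferrers tile of $\mu$ is the polyomino with $\ell+1$ bottom-justified columns, column $i$ ($0\leq i\leq\ell$, left to right) consisting of $\mu_i$ cells. An anchor word for $\mu$ (with parameter $d$, length $n$) is a word $a_1a_2\cdots a_n$ over the alphabet $\{1,2,\dotsc,d,\infty\}$ such that for every $i$ with $a_i\neq\infty$ we have $a_{i+k}\geq a_i+\mu_k$ for all $k=1,\dotsc,\ell$ (with $\infty$ regarded as larger than every integer), and $a_{n-\ell+1}=\cdots=a_n=\infty$ (so if $n\leq\ell$ every letter is $\infty$). -}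

module Defs where

open import Data.Nat using (ℕ; zero; suc; _+_; _∸_; _≤_; _<_; _≤?_; _<?_)
open import Data.Nat.Properties using (_≟_)
open import Data.Fin using (Fin; toℕ) renaming (zero to fzero; suc to fsuc)
open import Data.Fin.Properties using (any?)
open import Data.Maybe using (Maybe; just; nothing)
open import Data.Vec using (Vec; lookup)
open import Data.List using (List; length; filter)
open import Data.List.Relation.Binary.Permutation.Propositional using (↭-setoid)
open import Data.Product using (Σ; _×_; _,_; proj₁)
open import Data.Product.Properties using ()
open import Data.Unit using (⊤)
open import Relation.Nullary using (Dec; yes; no)
open import Relation.Nullary.Decidable using (_×-dec_)
open import Relation.Binary using (Setoid)
open import Relation.Binary.PropositionalEquality using (_≡_; setoid)
import Relation.Binary.Construct.On as On

IsPartition : {ℓ : ℕ} → (Fin (suc ℓ) → ℕ) → Set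
IsPartition {ℓ} μ =
  ((i j : Fin (suc ℓ)) → toℕ i ≤ toℕ j → μ j ≤ μ i) ×
  ((i : Fin (suc ℓ)) → 1 ≤ μ i)

-- Anchor words.  Alphabet {1,…,d,∞}: the letter `just v` (v : Fin d)
-- stands for the integer toℕ v + 1, and `nothing` stands for ∞.

Letter : ℕ → Set
Letter d = Maybe (Fin d)

LetterGE : {d : ℕ} → Letter d → ℕ → Set
LetterGE nothing  m = ⊤
LetterGE (just u) m = m ≤ suc (toℕ u)

-- Positions are 0-indexed: position i here is a_{i+1} in the paper.
IsAnchorWord : {ℓ : ℕ} → (Fin (suc ℓ) → ℕ) → (d n : ℕ) → Vec (Letter d) n → Set
IsAnchorWord {ℓ} μ d n w =
  ((i : Fin n) (v : Fin d) → lookup w i ≡ just v →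
     (k : Fin ℓ) (j : Fin n) → toℕ j ≡ toℕ i + suc (toℕ k) →
     LetterGE (lookup w j) (suc (toℕ v) + μ (fsuc k))) ×
  ((i : Fin n) → n ∸ ℓ ≤ toℕ i → lookup w i ≡ nothing)

AnchorWords : {ℓ : ℕ} → (Fin (suc ℓ) → ℕ) → (d n : ℕ) → Setoid _ _
AnchorWords μ d n =
  On.setoid {B = Σ (Vec (Letter _) n) (IsAnchorWord μ d n)}
            (setoid (Vec (Letter d) n)) proj₁

-- Tilings.  Cells are pairs (row , column), rows counted from the bottom.

Cell : Set
Cell = ℕ × ℕ

-- A placed tile: a unit square at a cell, or the translate of the Ferrers
-- tile of μ whose bottom-left cell is at (r , c).
data Tile : Set where
  square  : (r c : ℕ) → Tile
  ferrers : (r c : ℕ) → Tile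

Covers : {ℓ : ℕ} → (Fin (suc ℓ) → ℕ) → Tile → Cell → Set
Covers μ (square r c)  (x , y) = (x ≡ r) × (y ≡ c)
Covers μ (ferrers r c) (x , y) =
  Σ (Fin _) λ i → (y ≡ c + toℕ i) × (r ≤ x) × (x < r + μ i)

covers? : {ℓ : ℕ} (μ : Fin (suc ℓ) → ℕ) (t : Tile) (z : Cell) → Dec (Covers μ t z)
covers? μ (square r c)  (x , y) = (x ≟ r) ×-dec (y ≟ c)
covers? μ (ferrers r c) (x , y) =
  any? λ i → (y ≟ c + toℕ i) ×-dec ((r ≤? x) ×-dec (x <? r + μ i))

InBoard : ℕ → ℕ → Cell → Set
InBoard R n (x , y) = (x < R) × (y < n)

IsTiling : {ℓ : ℕ} → (Fin (suc ℓ) → ℕ) → (R n : ℕ) → List Tile → Set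
IsTiling μ R n ts =
  ((t : Tile) → t Data.List.Membership.Propositional.∈ ts →
     (z : Cell) → Covers μ t z → InBoard R n z) ×
  ((z : Cell) → InBoard R n z → length (filter (λ t → covers? μ t z) ts) ≡ 1)
  where import Data.List.Membership.Propositional

Tilings : {ℓ : ℕ} → (Fin (suc ℓ) → ℕ) → (d n : ℕ) → Setoid _ _
Tilings μ d n =
  On.setoid {B = Σ (List Tile) (IsTiling μ (μ fzero + d ∸ 1) n)} ↭-setoid proj₁

-- Read a letter a ≠ ∞ at position c as the Ferrers tile whose bottom-left cell is in
-- row a − 1 of column c, and fill the cells these tiles leave free with unit squares.
-- Because μ is weakly decreasing and every tile starts in a row below d ≤ μ₀, the tiles
-- at positions c and c + k (1 ≤ k ≤ ℓ) overlap exactly when a_{c+k} < a_c + μ_k: then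
-- the cell of column c + k in the higher of the two starting rows lies in both. So the
-- anchor inequalities say precisely that the Ferrers tiles are disjoint, and a ≤ d
-- together with the final ℓ letters being ∞ say that they lie in the board. Conversely,
-- distinct Ferrers tiles of a tiling start in distinct columns, so reading off their
-- starting rows gives a word, and a tiling is determined up to order by its Ferrers
-- tiles since the unit squares must fill the rest.
module Submission where

open import Defs
open import Data.Nat
  using (ℕ; zero; suc; pred; _+_; _∸_; _⊔_; _≤_; _<_; z≤n; s≤s; s≤s⁻¹; z<s; _<?_; >-nonZero)
open import Data.Fin using (Fin; toℕ; fromℕ; fromℕ<) renaming (zero to fzero; suc to fsuc)
open import Function.Bundles using (Bijection; _⇔_; mk⇔; Equivalence)

open import Data.Nat.Properties
open import Data.Fin.Properties using (toℕ-fromℕ; toℕ-fromℕ<; toℕ-injective; toℕ<n)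
open import Data.Maybe as Maybe using (Maybe; just; nothing)
open import Data.Maybe.Properties using (just-injective)
open import Data.Product using (Σ; _×_; _,_; proj₁; proj₂; ∃; map₁; map₂)
open import Data.Sum using (inj₁; inj₂; [_,_]′)
open import Data.Unit using (tt)
open import Data.Vec using (Vec; []; _∷_; lookup; tabulate)
open import Data.Vec.Properties using (lookup∘tabulate)
open import Data.List
  using (List; []; _∷_; _++_; length; filter; map; mapMaybe; upTo; cartesianProduct)
open import Data.List.Properties using (filter-none)
open import Data.List.Membership.Propositional using (_∈_; find; lose)
open import Data.List.Membership.Propositional.Properties
  using ( ∈-++⁻; ∈-++⁺ˡ; ∈-map⁺; ∈-filter⁺; ∈-map∘filter⁻; ∈-upTo⁺; ∈-upTo⁻
        ; ∈-cartesianProduct⁺; ∈-cartesianProduct⁻)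
open import Data.List.Membership.Propositional.Properties.WithK using (unique∧set⇒bag)
open import Data.List.Relation.Unary.Any using (Any; here; there; any?)
import Data.List.Relation.Unary.Any.Properties as AnyP
open import Data.List.Relation.Unary.All as All using (All)
open import Data.List.Relation.Unary.All.Properties using (¬Any⇒All¬)
open import Data.List.Relation.Unary.AllPairs as AllPairs using (AllPairs; []; _∷_)
import Data.List.Relation.Unary.AllPairs.Properties as AllPairsP
open import Data.List.Relation.Unary.Unique.Propositional using (Unique)
import Data.List.Relation.Unary.Unique.Propositional.Properties as UniqueP
open import Data.List.Relation.Binary.BagAndSetEquality using (∼bag⇒↭)
open import Data.List.Relation.Binary.Permutation.Propositional using (_↭_; ↭-sym; ↭-reflexive)
open import Data.List.Relation.Binary.Permutation.Propositional.Properties using (∈-resp-↭)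
open import Function using (_∘_; id; case_of_)
open import Function.Construct.Symmetry using (⇔-sym)
import Function.Related.Propositional as Related
open import Level using (Level)
open import Relation.Binary using (Rel; Symmetric)
open import Relation.Binary.PropositionalEquality
  using (_≡_; _≢_; refl; sym; trans; cong; cong₂; subst; module ≡-Reasoning)
open import Relation.Nullary using (¬_; ¬?; yes; no; contradiction)
open import Relation.Nullary.Decidable using (_×-dec_)
open import Relation.Unary using (Pred; Decidable)

private
  variable
    a p r : Level
    A B I : Set a

AtMostOne : Pred A p → List A → Set _
AtMostOne P = AllPairs (λ x y → ¬ (P x × P y))

module _ {P : Pred A p} (P? : Decidable P) where

  atMostOne⇒length-filter≤1 : ∀ {xs} → AtMostOne P xs → length (filter P? xs) ≤ 1
  atMostOne⇒length-filter≤1 [] = z≤n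
  atMostOne⇒length-filter≤1 {x ∷ xs} (x# ∷ xs#) with P? x
  ... | yes px = s≤s (≤-reflexive (cong length (filter-none P? (All.map (_∘ (px ,_)) x#))))
  ... | no  _  = atMostOne⇒length-filter≤1 xs#

  Any⇒1≤length-filter : ∀ {xs} → Any P xs → 1 ≤ length (filter P? xs)
  Any⇒1≤length-filter {x ∷ _} any with P? x | any
  ... | yes _  | _         = s≤s z≤n
  ... | no ¬px | here px   = contradiction px ¬px
  ... | no _   | there any = Any⇒1≤length-filter any

  length-filter≤1⇒atMostOne : ∀ xs → length (filter P? xs) ≤ 1 → AtMostOne P xs
  length-filter≤1⇒atMostOne []       _  = []
  length-filter≤1⇒atMostOne (x ∷ xs) ≤1 with P? x
  ... | yes _  = All.map (λ ¬py → ¬py ∘ proj₂) (¬Any⇒All¬ xs none) ∷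
                 length-filter≤1⇒atMostOne xs (≤-trans (n≤1+n _) ≤1)
    where
    none : ¬ Any P xs
    none any with () ← ≤-trans (Any⇒1≤length-filter any) (s≤s⁻¹ ≤1)
  ... | no ¬px = All.tabulate (λ _ → ¬px ∘ proj₁) ∷ length-filter≤1⇒atMostOne xs ≤1

  1≤length-filter⇒Any : ∀ xs → 1 ≤ length (filter P? xs) → Any P xs
  1≤length-filter⇒Any (x ∷ xs) ≥1 with P? x
  ... | yes px = here px
  ... | no  _  = there (1≤length-filter⇒Any xs ≥1)

  length-filter≡1⇔ : ∀ {xs} → length (filter P? xs) ≡ 1 ⇔ (Any P xs × AtMostOne P xs)
  length-filter≡1⇔ {xs} = mk⇔
    (λ ≡1 → 1≤length-filter⇒Any xs (≤-reflexive (sym ≡1)) ,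
           length-filter≤1⇒atMostOne xs (≤-reflexive ≡1))
    (λ (any , one) → ≤-antisym (atMostOne⇒length-filter≤1 one) (Any⇒1≤length-filter any))

AllPairs-∀ : ∀ {R : I → Rel A r} {xs} → (∀ i → AllPairs (R i) xs) →
             AllPairs (λ x y → ∀ i → R i x y) xs
AllPairs-∀ {xs = []}    _     = []
AllPairs-∀ {xs = _ ∷ _} pairs =
  All.tabulate (λ y∈xs i → All.lookup (AllPairs.head (pairs i)) y∈xs) ∷
  AllPairs-∀ (AllPairs.tail ∘ pairs)

AllPairs-∈ : ∀ {R : Rel A r} → Symmetric R → ∀ {xs x y} → AllPairs R xs →
             x ∈ xs → y ∈ xs → x ≢ y → R x y
AllPairs-∈ _     (_ ∷ _)   (here refl) (here refl) x≢y = contradiction refl x≢y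
AllPairs-∈ _     (x# ∷ _)  (here refl) (there y∈)  _   = All.lookup x# y∈
AllPairs-∈ R-sym (x# ∷ _)  (there x∈)  (here refl) _   = R-sym (All.lookup x# x∈)
AllPairs-∈ R-sym (_ ∷ xs#) (there x∈)  (there y∈)  x≢y = AllPairs-∈ R-sym xs# x∈ y∈ x≢y

unique∧∈⇔⇒↭ : ∀ {xs ys : List A} → Unique xs → Unique ys →
              (∀ {x} → x ∈ xs ⇔ x ∈ ys) → xs ↭ ys
unique∧∈⇔⇒↭ xs! ys! same = ∼bag⇒↭ (unique∧set⇒bag xs! ys! same)

∈-↭⇔ : ∀ {xs ys : List A} {x} → xs ↭ ys → x ∈ xs ⇔ x ∈ ys
∈-↭⇔ xs↭ys = mk⇔ (∈-resp-↭ xs↭ys) (∈-resp-↭ (↭-sym xs↭ys))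

just-⇔⇒≡ : ∀ {m m′ : Maybe A} → (∀ {x} → m ≡ just x ⇔ m′ ≡ just x) → m ≡ m′
just-⇔⇒≡ {m = just _}                 same = sym (Equivalence.to same refl)
just-⇔⇒≡ {m = nothing} {m′ = just _}  same = Equivalence.from same refl
just-⇔⇒≡ {m = nothing} {m′ = nothing} _    = refl

module _ (g : A → Maybe B) where

  ∈-mapMaybe⁺ : ∀ {xs x y} → x ∈ xs → g x ≡ just y → y ∈ mapMaybe g xs
  ∈-mapMaybe⁺ {x ∷ _} (here refl) gx≡y with g x
  ... | just _  = here (sym (just-injective gx≡y))
  ∈-mapMaybe⁺ {x ∷ _} (there x∈) gx≡y with g x
  ... | just _  = there (∈-mapMaybe⁺ x∈ gx≡y)
  ... | nothing = ∈-mapMaybe⁺ x∈ gx≡y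

  ∈-mapMaybe⁻ : ∀ xs {y} → y ∈ mapMaybe g xs → ∃ λ x → x ∈ xs × g x ≡ just y
  ∈-mapMaybe⁻ (x ∷ xs) y∈ with g x in gx≡
  ∈-mapMaybe⁻ (x ∷ xs) (here refl) | just _  = x , here refl , gx≡
  ∈-mapMaybe⁻ (x ∷ xs) (there y∈)  | just _  = map₂ (map₁ there) (∈-mapMaybe⁻ xs y∈)
  ∈-mapMaybe⁻ (x ∷ xs) y∈          | nothing = map₂ (map₁ there) (∈-mapMaybe⁻ xs y∈)

  AllPairs-mapMaybe⁺ : ∀ {R : Rel B r} {xs} →
                       AllPairs (λ x x′ → ∀ {y y′} → g x ≡ just y → g x′ ≡ just y′ → R y y′) xs →
                       AllPairs R (mapMaybe g xs)
  AllPairs-mapMaybe⁺ [] = []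
  AllPairs-mapMaybe⁺ {R = R} {x ∷ xs} (x# ∷ xs#) with g x
  ... | nothing = AllPairs-mapMaybe⁺ xs#
  ... | just y  = All.tabulate related ∷ AllPairs-mapMaybe⁺ xs#
    where
    related : ∀ {y′} → y′ ∈ mapMaybe g xs → R y y′
    related y′∈ with x′ , x′∈ , gx′ ← ∈-mapMaybe⁻ xs y′∈ = All.lookup x# x′∈ refl gx′

m<n∸o⇒m+o<n : ∀ {m n o} → m < n ∸ o → m + o < n
m<n∸o⇒m+o<n {m} {n}     {zero}  m<n = subst (_< n) (sym (+-identityʳ m)) m<n
m<n∸o⇒m+o<n {m} {suc n} {suc o} m<  = subst (_< suc n) (sym (+-suc m o)) (s≤s (m<n∸o⇒m+o<n m<))

columnOffset : ∀ {ℓ c c′} {i j : Fin (suc ℓ)} → c + toℕ i ≡ c′ + toℕ j → c < c′ →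
               ∃ λ (k : Fin ℓ) → c′ ≡ c + suc (toℕ k) × suc (toℕ k) ≤ toℕ i
columnOffset {ℓ} {c} {c′} {i} {j} same c<c′ =
  fromℕ< s<ℓ ,
  subst (λ m → c′ ≡ c + suc m) (sym (toℕ-fromℕ< s<ℓ)) c′≡c+1+s ,
  subst (λ m → suc m ≤ toℕ i) (sym (toℕ-fromℕ< s<ℓ)) 1+s≤i
  where
  s : ℕ
  s = c′ ∸ suc c
  c′≡c+1+s : c′ ≡ c + suc s
  c′≡c+1+s = sym (trans (+-suc c s) (m+[n∸m]≡n c<c′))
  i≡1+s+j : toℕ i ≡ suc s + toℕ j
  i≡1+s+j = +-cancelˡ-≡ c _ _ (begin
    c + toℕ i           ≡⟨ same ⟩
    c′ + toℕ j          ≡⟨ cong (_+ toℕ j) c′≡c+1+s ⟩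
    c + suc s + toℕ j   ≡⟨ +-assoc c (suc s) (toℕ j) ⟩
    c + (suc s + toℕ j) ∎)
    where open ≡-Reasoning
  1+s≤i : suc s ≤ toℕ i
  1+s≤i = subst (suc s ≤_) (sym i≡1+s+j) (m≤m+n (suc s) (toℕ j))
  s<ℓ : s < ℓ
  s<ℓ = s≤s⁻¹ (≤-<-trans 1+s≤i (toℕ<n i))

lookupℕ : ∀ {n} → Vec (Maybe A) n → ℕ → Maybe A
lookupℕ []       _       = nothing
lookupℕ (x ∷ _)  zero    = x
lookupℕ (_ ∷ xs) (suc c) = lookupℕ xs c

lookupℕ-just : ∀ {n} (xs : Vec (Maybe A) n) c {x} → lookupℕ xs c ≡ just x →
               ∃ λ i → toℕ i ≡ c × lookup xs i ≡ just x
lookupℕ-just (_ ∷ _)  zero    eq = fzero , refl , eq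
lookupℕ-just (_ ∷ xs) (suc c) eq with i , refl , eq′ ← lookupℕ-just xs c eq = fsuc i , refl , eq′

lookupℕ-tabulate : ∀ {n} (f : ℕ → Maybe A) → (∀ {c x} → f c ≡ just x → c < n) →
                   ∀ c → lookupℕ (tabulate {n = n} (f ∘ toℕ)) c ≡ f c
lookupℕ-tabulate {n = zero}  f bounded c with f c in eq
... | nothing = refl
... | just _  with () ← bounded eq
lookupℕ-tabulate {n = suc n} f bounded zero    = refl
lookupℕ-tabulate {n = suc n} f bounded (suc c) = lookupℕ-tabulate (f ∘ suc) (s≤s⁻¹ ∘ bounded) c

lookupℕ-injective : ∀ {n} {xs ys : Vec (Maybe A) n} →
                    (∀ c → lookupℕ xs c ≡ lookupℕ ys c) → xs ≡ ys
lookupℕ-injective {xs = []}    {[]}    _  = refl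
lookupℕ-injective {xs = _ ∷ _} {_ ∷ _} eq = cong₂ _∷_ (eq zero) (lookupℕ-injective (eq ∘ suc))

module ExactCovers {ℓ : ℕ} (μ : Fin (suc ℓ) → ℕ) where

  Disjoint : Tile → Tile → Set
  Disjoint s t = ∀ z → ¬ (Covers μ s z × Covers μ t z)

  record IsExactCover (R n : ℕ) (ts : List Tile) : Set where
    field
      within   : ∀ {t z} → t ∈ ts → Covers μ t z → InBoard R n z
      covered  : ∀ {z} → InBoard R n z → Any (λ t → Covers μ t z) ts
      disjoint : AllPairs Disjoint ts

    disjoint-∈ : ∀ {s t} → s ∈ ts → t ∈ ts → s ≢ t → Disjoint s t
    disjoint-∈ = AllPairs-∈ (λ s#t z (p , q) → s#t z (q , p)) disjoint

  isTiling⇒isExactCover : ∀ {R n ts} → IsTiling μ R n ts → IsExactCover R n ts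
  isTiling⇒isExactCover {R} {n} {ts} (within , once) = record
    { within   = λ t∈ts → within _ t∈ts _
    ; covered  = λ {z} z∈ → proj₁ (Equivalence.to (length-filter≡1⇔ _) (once z z∈))
    ; disjoint = AllPairs-∀ pairsAt
    }
    where
    pairsAt : ∀ z → AtMostOne (λ t → Covers μ t z) ts
    pairsAt z@(x , y) with (x <? R) ×-dec (y <? n)
    ... | yes z∈ = proj₂ (Equivalence.to (length-filter≡1⇔ _) (once z z∈))
    ... | no  z∉ = length-filter≤1⇒atMostOne (λ t → covers? μ t z) ts
                     (≤-trans (≤-reflexive (cong length (filter-none _ uncovered))) z≤n)
      where
      uncovered : All (λ t → ¬ Covers μ t z) ts
      uncovered = All.tabulate (λ t∈ts cov → z∉ (within _ t∈ts _ cov))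

  isExactCover⇒isTiling : ∀ {R n ts} → IsExactCover R n ts → IsTiling μ R n ts
  isExactCover⇒isTiling T = (λ _ t∈ts _ → within t∈ts) , λ z z∈ →
    Equivalence.from (length-filter≡1⇔ _) (covered z∈ , AllPairs.map (λ s#t → s#t z) disjoint)
    where open IsExactCover T

module AnchorTilings {ℓ : ℕ} (μ : Fin (suc ℓ) → ℕ) (isPartition : IsPartition μ)
                     (d : ℕ) (d≤μ₀ : d ≤ μ fzero) (n : ℕ) where

  open ExactCovers μ

  antitone : ∀ {i j} → toℕ i ≤ toℕ j → μ j ≤ μ i
  antitone = proj₁ isPartition _ _

  positive : ∀ i → 0 < μ i
  positive = proj₂ isPartition

  rows : ℕ
  rows = μ fzero + d ∸ 1

  topOffset : ℕ
  topOffset = pred (μ fzero)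

  μ₀≡1+topOffset : μ fzero ≡ suc topOffset
  μ₀≡1+topOffset = sym (suc-pred (μ fzero) {{>-nonZero (positive fzero)}})

  rows≡topOffset+d : rows ≡ topOffset + d
  rows≡topOffset+d = cong (λ m → m + d ∸ 1) μ₀≡1+topOffset

  ferrers-cell<rows : ∀ {x r} i → x < r + μ i → r < d → x < rows
  ferrers-cell<rows {x} {r} i x< r<d = begin-strict
    x                 <⟨ x< ⟩
    r + μ i           ≤⟨ +-monoʳ-≤ r (antitone z≤n) ⟩
    r + μ fzero       ≡⟨ cong (r +_) μ₀≡1+topOffset ⟩
    r + suc topOffset ≡⟨ +-suc r topOffset ⟩
    suc r + topOffset ≤⟨ +-monoˡ-≤ topOffset r<d ⟩
    d + topOffset     ≡⟨ +-comm d topOffset ⟩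
    topOffset + d     ≡⟨ rows≡topOffset+d ⟨
    rows              ∎
    where open ≤-Reasoning

  origin : Tile → Cell
  origin (square  r c) = r , c
  origin (ferrers r c) = r , c

  covers-origin : ∀ t → Covers μ t (origin t)
  covers-origin (square  r c) = refl , refl
  covers-origin (ferrers r c) = fzero , sym (+-identityʳ c) , ≤-refl , m<m+n r (positive fzero)

  covers-top : ∀ r c → Covers μ (ferrers r c) (r + topOffset , c)
  covers-top r c = fzero , sym (+-identityʳ c) , m≤m+n r topOffset ,
                   ≤-reflexive (trans (sym (+-suc r topOffset)) (cong (r +_) (sym μ₀≡1+topOffset)))

  covers-last : ∀ r c → Covers μ (ferrers r c) (r , c + ℓ)
  covers-last r c = fromℕ ℓ , cong (c +_) (sym (toℕ-fromℕ ℓ)) , ≤-refl , m<m+n r (positive (fromℕ ℓ))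

  sharedCell : ∀ {a b c c′} i → c′ ≡ c + toℕ i → b < a + μ i → a < b + μ fzero →
               Covers μ (ferrers a c) (a ⊔ b , c′) × Covers μ (ferrers b c′) (a ⊔ b , c′)
  sharedCell {a} {b} {c′ = c′} i c′≡ b< a< =
    (i , c′≡ , m≤m⊔n a b , ⊔-lub (m<m+n a (positive i)) b<) ,
    (fzero , sym (+-identityʳ c′) , m≤n⊔m a b , ⊔-lub a< (m<m+n b (positive fzero)))

  ferrers-injective : ∀ {r r′ c c′} → ferrers r c ≡ ferrers r′ c′ → r ≡ r′ × c ≡ c′
  ferrers-injective refl = refl , refl

  FerrersFree : List Tile → Cell → Set
  FerrersFree ts z = ∀ {r c} → ferrers r c ∈ ts → ¬ Covers μ (ferrers r c) z

  module _ {ts : List Tile} (T : IsExactCover rows n ts) where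
    open IsExactCover T

    unique : Unique ts
    unique = AllPairs.map distinct disjoint
      where
      distinct : ∀ {s t} → Disjoint s t → s ≢ t
      distinct {s} s#t refl = s#t (origin s) (covers-origin s , covers-origin s)

    ferrers-row< : ∀ {r c} → ferrers r c ∈ ts → r < d
    ferrers-row< {r} {c} f∈ = +-cancelʳ-< topOffset r d (begin-strict
      r + topOffset <⟨ proj₁ (within f∈ (covers-top r c)) ⟩
      rows          ≡⟨ rows≡topOffset+d ⟩
      topOffset + d ≡⟨ +-comm topOffset d ⟩
      d + topOffset ∎)
      where open ≤-Reasoning

    ferrers-fits : ∀ {r c} → ferrers r c ∈ ts → c + ℓ < n
    ferrers-fits {r} {c} f∈ = proj₂ (within f∈ (covers-last r c))

    ferrers-row<+μ₀ : ∀ {a c} b → ferrers a c ∈ ts → a < b + μ fzero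
    ferrers-row<+μ₀ b f∈ = <-≤-trans (<-≤-trans (ferrers-row< f∈) d≤μ₀) (m≤n+m _ b)

    ferrers-column-unique : ∀ {r r′ c} → ferrers r c ∈ ts → ferrers r′ c ∈ ts → r ≡ r′
    ferrers-column-unique {r} {r′} {c} f∈ f′∈ with r ≟ r′
    ... | yes r≡r′ = r≡r′
    ... | no  r≢r′ = contradiction
      (sharedCell fzero (sym (+-identityʳ c)) (ferrers-row<+μ₀ r f′∈) (ferrers-row<+μ₀ r′ f∈))
      (disjoint-∈ f∈ f′∈ (r≢r′ ∘ proj₁ ∘ ferrers-injective) _)

    ferrers-spacing : ∀ {a b c} (k : Fin ℓ) → ferrers a c ∈ ts → ferrers b (c + suc (toℕ k)) ∈ ts →
                      a + μ (fsuc k) ≤ b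
    ferrers-spacing {a} {b} {c} k fa∈ fb∈ = ≮⇒≥ λ b< →
      disjoint-∈ fa∈ fb∈ (<⇒≢ (m<m+n c z<s) ∘ proj₂ ∘ ferrers-injective) _
        (sharedCell (fsuc k) refl b< (ferrers-row<+μ₀ b fa∈))

    square∈⇔ferrersFree : ∀ {x y} →
                          square x y ∈ ts ⇔ (InBoard rows n (x , y) × FerrersFree ts (x , y))
    square∈⇔ferrersFree {x} {y} = mk⇔
      (λ s∈ → within s∈ (refl , refl) ,
              λ {r} {c} f∈ cov → disjoint-∈ s∈ f∈ (λ ()) _ ((refl , refl) , cov))
      (λ (z∈ , free) → coveringSquare (λ {r} {c} → free {r} {c}) (find (covered z∈)))
      where
      coveringSquare : FerrersFree ts (x , y) → (∃ λ t → t ∈ ts × Covers μ t (x , y)) →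
                       square x y ∈ ts
      coveringSquare _    (square _ _  , s∈ , refl , refl) = s∈
      coveringSquare free (ferrers _ _ , f∈ , cov)         = contradiction cov (free f∈)

  rowAt : List Tile → ℕ → Letter d
  rowAt []                  _ = nothing
  rowAt (square _ _ ∷ ts)   c = rowAt ts c
  rowAt (ferrers r c′ ∷ ts) c with c′ ≟ c | r <? d
  ... | yes _ | yes r<d = just (fromℕ< r<d)
  ... | _     | _       = rowAt ts c

  rowAt-just⁻ : ∀ ts {c v} → rowAt ts c ≡ just v → ferrers (toℕ v) c ∈ ts
  rowAt-just⁻ (square _ _ ∷ ts)       eq = there (rowAt-just⁻ ts eq)
  rowAt-just⁻ (ferrers r c′ ∷ ts) {c} eq with c′ ≟ c | r <? d
  rowAt-just⁻ (ferrers r c′ ∷ ts) refl | yes refl | yes r<d =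
    here (cong₂ ferrers (toℕ-fromℕ< r<d) refl)
  ... | yes _ | no _ = there (rowAt-just⁻ ts eq)
  ... | no _  | _    = there (rowAt-just⁻ ts eq)

  rowAt-just⁺ : ∀ {ts r c} → ferrers r c ∈ ts → r < d → ∃ λ v → rowAt ts c ≡ just v
  rowAt-just⁺ {square _ _ ∷ ts} (there f∈) r<d = rowAt-just⁺ f∈ r<d
  rowAt-just⁺ {ferrers r′ c′ ∷ ts} {c = c} f∈ r<d with c′ ≟ c | r′ <? d | f∈
  ... | yes _   | yes r′<d | _          = fromℕ< r′<d , refl
  ... | yes _   | no r′≮d  | here refl  = contradiction r<d r′≮d
  ... | yes _   | no _     | there f∈′  = rowAt-just⁺ f∈′ r<d
  ... | no c′≢c | _        | here refl  = contradiction refl c′≢c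
  ... | no _    | _        | there f∈′  = rowAt-just⁺ f∈′ r<d

  rowAt≡just⇔ : ∀ {ts} → IsExactCover rows n ts →
                ∀ {c v} → rowAt ts c ≡ just v ⇔ ferrers (toℕ v) c ∈ ts
  rowAt≡just⇔ {ts} T {c} {v} = mk⇔ (rowAt-just⁻ ts) λ f∈ →
    let v′ , eq = rowAt-just⁺ f∈ (toℕ<n v)
        v′≡v    = toℕ-injective (ferrers-column-unique T (rowAt-just⁻ ts eq) f∈)
    in subst (λ u → rowAt ts c ≡ just u) v′≡v eq

  -- An anchor word indexed by ℕ (via lookupℕ, so nothing past its end), which keeps the
  -- position arithmetic c + k free of Fin bounds.
  record IsAnchorSequence (f : ℕ → Letter d) : Set where
    field
      spacing : ∀ {c a b} (k : Fin ℓ) → f c ≡ just a → f (c + suc (toℕ k)) ≡ just b →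
                toℕ a + μ (fsuc k) ≤ toℕ b
      fits    : ∀ {c a} → f c ≡ just a → c + ℓ < n

    bounded : ∀ {c a} → f c ≡ just a → c < n
    bounded {c} fc = ≤-<-trans (m≤m+n c ℓ) (fits fc)

  isAnchorWord⇒isAnchorSequence : ∀ w → IsAnchorWord μ d n w → IsAnchorSequence (lookupℕ w)
  isAnchorWord⇒isAnchorSequence w (spaced , lastInfinite) = record { spacing = spacing ; fits = fits }
    where
    spacing : ∀ {c a b} (k : Fin ℓ) → lookupℕ w c ≡ just a → lookupℕ w (c + suc (toℕ k)) ≡ just b →
              toℕ a + μ (fsuc k) ≤ toℕ b
    spacing {c} k wc wc′
      with i , refl , wi ← lookupℕ-just w c wc | j , j≡ , wj ← lookupℕ-just w _ wc′ =
      s≤s⁻¹ (subst (λ l → LetterGE l _) wj (spaced i _ wi k j j≡))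
    fits : ∀ {c a} → lookupℕ w c ≡ just a → c + ℓ < n
    fits {c} wc with i , refl , wi ← lookupℕ-just w c wc =
      m<n∸o⇒m+o<n (≰⇒> λ late → case trans (sym wi) (lastInfinite i late) of λ ())

  isAnchorSequence⇒isAnchorWord : ∀ {f} → IsAnchorSequence f →
                                  IsAnchorWord μ d n (tabulate (f ∘ toℕ))
  isAnchorSequence⇒isAnchorWord {f} F = spaced , lastInfinite
    where
    open IsAnchorSequence F
    spaced : ∀ i v → lookup (tabulate (f ∘ toℕ)) i ≡ just v → ∀ k j → toℕ j ≡ toℕ i + suc (toℕ k) →
             LetterGE (lookup (tabulate (f ∘ toℕ)) j) (suc (toℕ v) + μ (fsuc k))
    spaced i v fi k j j≡ rewrite lookup∘tabulate (f ∘ toℕ) j | j≡ with f (toℕ i + suc (toℕ k)) in fj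
    ... | nothing = tt
    ... | just _  = s≤s (spacing k (trans (sym (lookup∘tabulate (f ∘ toℕ) i)) fi) fj)
    lastInfinite : ∀ i → n ∸ ℓ ≤ toℕ i → lookup (tabulate (f ∘ toℕ)) i ≡ nothing
    lastInfinite i late rewrite lookup∘tabulate (f ∘ toℕ) i with f (toℕ i) in fi
    ... | nothing = refl
    ... | just _  = contradiction late (<⇒≱ (m+n≤o⇒m≤o∸n (suc (toℕ i)) (fits fi)))

  rowAt-isAnchorSequence : ∀ {ts} → IsExactCover rows n ts → IsAnchorSequence (rowAt ts)
  rowAt-isAnchorSequence {ts} T = record
    { spacing = λ k ra rb → ferrers-spacing T k (rowAt-just⁻ ts ra) (rowAt-just⁻ ts rb)
    ; fits    = λ ra → ferrers-fits T (rowAt-just⁻ ts ra)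
    }

  squareAt : Cell → Tile
  squareAt (x , y) = square x y

  covers-squareAt : ∀ z → Covers μ (squareAt z) z
  covers-squareAt (x , y) = refl , refl

  covers-squareAt⇒≡ : ∀ {z w} → Covers μ (squareAt z) w → w ≡ z
  covers-squareAt⇒≡ {x , y} (refl , refl) = refl

  ferrers≢squareAt : ∀ {r c} z → ferrers r c ≢ squareAt z
  ferrers≢squareAt (x , y) ()

  boardCells : List Cell
  boardCells = cartesianProduct (upTo rows) (upTo n)

  ∈-boardCells⁺ : ∀ {z} → InBoard rows n z → z ∈ boardCells
  ∈-boardCells⁺ (x< , y<) = ∈-cartesianProduct⁺ (∈-upTo⁺ x<) (∈-upTo⁺ y<)

  ∈-boardCells⁻ : ∀ {z} → z ∈ boardCells → InBoard rows n z
  ∈-boardCells⁻ z∈ with x∈ , y∈ ← ∈-cartesianProduct⁻ (upTo rows) (upTo n) z∈ =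
    ∈-upTo⁻ x∈ , ∈-upTo⁻ y∈

  module _ (f : ℕ → Letter d) where

    -- The letter just v is the integer toℕ v + 1, so its tile starts in row toℕ v.
    ferrersAt : ℕ → Maybe Tile
    ferrersAt c = Maybe.map (λ v → ferrers (toℕ v) c) (f c)

    ferrersTiles : List Tile
    ferrersTiles = mapMaybe ferrersAt (upTo n)

    uncovered? : Decidable (λ z → ¬ Any (λ t → Covers μ t z) ferrersTiles)
    uncovered? z = ¬? (any? (λ t → covers? μ t z) ferrersTiles)

    squareTiles : List Tile
    squareTiles = map squareAt (filter uncovered? boardCells)

    tilesOf : List Tile
    tilesOf = ferrersTiles ++ squareTiles

  ferrersAt-just : ∀ f c {t} → ferrersAt f c ≡ just t →
                   ∃ λ v → f c ≡ just v × t ≡ ferrers (toℕ v) c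
  ferrersAt-just f c eq with f c
  ... | just v = v , refl , sym (just-injective eq)

  squareTiles-disjoint : ∀ f → AllPairs Disjoint (squareTiles f)
  squareTiles-disjoint f =
    AllPairsP.map⁺ (AllPairs.map distinctCells (UniqueP.filter⁺ (uncovered? f) boardCells-unique))
    where
    boardCells-unique : Unique boardCells
    boardCells-unique = UniqueP.cartesianProduct⁺ (UniqueP.upTo⁺ rows) (UniqueP.upTo⁺ n)
    distinctCells : ∀ {z z′} → z ≢ z′ → Disjoint (squareAt z) (squareAt z′)
    distinctCells z≢z′ w (p , q) = z≢z′ (trans (sym (covers-squareAt⇒≡ p)) (covers-squareAt⇒≡ q))

  module _ {f : ℕ → Letter d} (F : IsAnchorSequence f) where
    open IsAnchorSequence F

    ferrersAt-disjoint : ∀ {c c′ t t′} → c < c′ → ferrersAt f c ≡ just t → ferrersAt f c′ ≡ just t′ →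
                         Disjoint t t′
    ferrersAt-disjoint {c} {c′} c<c′ ft ft′ (x , y) (cov , cov′)
      with a , fc , refl ← ferrersAt-just f c ft | b , fc′ , refl ← ferrersAt-just f c′ ft′
      with i , y≡ , _ , x< ← cov | j , y≡′ , b≤x , _ ← cov′
      with k , refl , 1+k≤i ← columnOffset {i = i} {j = j} (trans (sym y≡) y≡′) c<c′ =
      contradiction b≤x (<⇒≱ (begin-strict
        x                  <⟨ x< ⟩
        toℕ a + μ i        ≤⟨ +-monoʳ-≤ (toℕ a) (antitone 1+k≤i) ⟩
        toℕ a + μ (fsuc k) ≤⟨ spacing k fc fc′ ⟩
        toℕ b              ∎))
      where open ≤-Reasoning

    ferrersTiles-disjoint : AllPairs Disjoint (ferrersTiles f)
    ferrersTiles-disjoint =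
      AllPairs-mapMaybe⁺ (ferrersAt f)
        (AllPairsP.applyUpTo⁺₁ id n (λ c<c′ _ → ferrersAt-disjoint c<c′))

    ferrersTiles-within : ∀ {t z} → t ∈ ferrersTiles f → Covers μ t z → InBoard rows n z
    ferrersTiles-within t∈ cov
      with c , _ , ft ← ∈-mapMaybe⁻ (ferrersAt f) (upTo n) t∈
      with v , fc , refl ← ferrersAt-just f c ft
      with i , refl , _ , x< ← cov =
      ferrers-cell<rows i x< (toℕ<n v) , ≤-<-trans (+-monoʳ-≤ c (s≤s⁻¹ (toℕ<n i))) (fits fc)

    squareTiles-within : ∀ {t z} → t ∈ squareTiles f → Covers μ t z → InBoard rows n z
    squareTiles-within s∈ cov
      with z , z∈ , refl , _ ← ∈-map∘filter⁻ squareAt (uncovered? f) {xs = boardCells} s∈ =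
      subst (InBoard rows n) (sym (covers-squareAt⇒≡ cov)) (∈-boardCells⁻ z∈)

    ferrers-square-disjoint : ∀ {t s} → t ∈ ferrersTiles f → s ∈ squareTiles f → Disjoint t s
    ferrers-square-disjoint {t} t∈ s∈ w (p , q)
      with z , _ , refl , free ← ∈-map∘filter⁻ squareAt (uncovered? f) {xs = boardCells} s∈ =
      free (lose t∈ (subst (Covers μ t) (covers-squareAt⇒≡ q) p))

    tilesOf-isExactCover : IsExactCover rows n (tilesOf f)
    tilesOf-isExactCover = record
      { within   = λ t∈ → [ ferrersTiles-within , squareTiles-within ]′ (∈-++⁻ (ferrersTiles f) t∈)
      ; covered  = covered
      ; disjoint = AllPairsP.++⁺ ferrersTiles-disjoint (squareTiles-disjoint f)
                     (All.tabulate λ t∈ → All.tabulate λ s∈ → ferrers-square-disjoint t∈ s∈)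
      }
      where
      covered : ∀ {z} → InBoard rows n z → Any (λ t → Covers μ t z) (tilesOf f)
      covered {z} z∈ with any? (λ t → covers? μ t z) (ferrersTiles f)
      ... | yes byFerrers = AnyP.++⁺ˡ byFerrers
      ... | no  free      = AnyP.++⁺ʳ (ferrersTiles f)
        (lose (∈-map⁺ squareAt (∈-filter⁺ (uncovered? f) (∈-boardCells⁺ z∈) free)) (covers-squareAt z))

    ferrers∈tilesOf⇔ : ∀ {c v} → ferrers (toℕ v) c ∈ tilesOf f ⇔ f c ≡ just v
    ferrers∈tilesOf⇔ {c} {v} = mk⇔ placed place
      where
      placed : ferrers (toℕ v) c ∈ tilesOf f → f c ≡ just v
      placed t∈ with ∈-++⁻ (ferrersTiles f) t∈
      ... | inj₂ s∈
        with z , _ , eq , _ ← ∈-map∘filter⁻ squareAt (uncovered? f) {xs = boardCells} s∈ =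
        contradiction eq (ferrers≢squareAt z)
      ... | inj₁ f∈
        with c′ , _ , ft ← ∈-mapMaybe⁻ (ferrersAt f) (upTo n) f∈
        with v′ , fc′ , eq ← ferrersAt-just f c′ ft
        with v≡v′ , refl ← ferrers-injective eq
        with refl ← toℕ-injective v≡v′ = fc′
      place : f c ≡ just v → ferrers (toℕ v) c ∈ tilesOf f
      place fc =
        ∈-++⁺ˡ (∈-mapMaybe⁺ (ferrersAt f) (∈-upTo⁺ (bounded fc)) (cong (Maybe.map _) fc))

  SameFerrers : List Tile → List Tile → Set
  SameFerrers ts ts′ = ∀ {v : Fin d} {c} → ferrers (toℕ v) c ∈ ts ⇔ ferrers (toℕ v) c ∈ ts′

  ferrers⊆ : ∀ {ts ts′} → IsExactCover rows n ts →
             (∀ {v c} → ferrers (toℕ v) c ∈ ts → ferrers (toℕ v) c ∈ ts′) →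
             ∀ {r c} → ferrers r c ∈ ts → ferrers r c ∈ ts′
  ferrers⊆ {ts} {ts′} T sub {r} {c} f∈ =
    subst (λ m → ferrers m c ∈ ts′) (toℕ-fromℕ< r<d)
      (sub (subst (λ m → ferrers m c ∈ ts) (sym (toℕ-fromℕ< r<d)) f∈))
    where
    r<d : r < d
    r<d = ferrers-row< T f∈

  sameFerrers⇒⊆ : ∀ {ts ts′} → IsExactCover rows n ts → IsExactCover rows n ts′ → SameFerrers ts ts′ →
                  ∀ {t} → t ∈ ts → t ∈ ts′
  sameFerrers⇒⊆ T T′ same {ferrers r c} f∈ = ferrers⊆ T (Equivalence.to same) f∈
  sameFerrers⇒⊆ T T′ same {square x y} s∈
    with z∈ , free ← Equivalence.to (square∈⇔ferrersFree T) s∈ =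
    Equivalence.from (square∈⇔ferrersFree T′) (z∈ , λ f∈ → free (ferrers⊆ T′ (Equivalence.from same) f∈))

  sameFerrers⇒↭ : ∀ {ts ts′} → IsExactCover rows n ts → IsExactCover rows n ts′ → SameFerrers ts ts′ →
                  ts ↭ ts′
  sameFerrers⇒↭ T T′ same = unique∧∈⇔⇒↭ (unique T) (unique T′)
    (mk⇔ (sameFerrers⇒⊆ T T′ same) (sameFerrers⇒⊆ T′ T (⇔-sym same)))

  tilesOf-injective : ∀ {w w′} → IsAnchorWord μ d n w → IsAnchorWord μ d n w′ →
                      tilesOf (lookupℕ w) ↭ tilesOf (lookupℕ w′) → w ≡ w′
  tilesOf-injective {w} {w′} A A′ same = lookupℕ-injective λ c → just-⇔⇒≡ λ {v} → begin
    lookupℕ w c ≡ just v                     ∼⟨ ⇔-sym (ferrers∈tilesOf⇔ W) ⟩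
    ferrers (toℕ v) c ∈ tilesOf (lookupℕ w)  ∼⟨ ∈-↭⇔ same ⟩
    ferrers (toℕ v) c ∈ tilesOf (lookupℕ w′) ∼⟨ ferrers∈tilesOf⇔ W′ ⟩
    lookupℕ w′ c ≡ just v                    ∎
    where
    open Related.EquationalReasoning {k = Related.equivalence}
    W : IsAnchorSequence (lookupℕ w)
    W = isAnchorWord⇒isAnchorSequence w A
    W′ : IsAnchorSequence (lookupℕ w′)
    W′ = isAnchorWord⇒isAnchorSequence w′ A′

  wordOf : List Tile → Vec (Letter d) n
  wordOf ts = tabulate (rowAt ts ∘ toℕ)

  tilesOf-wordOf : ∀ {ts} → IsExactCover rows n ts → tilesOf (lookupℕ (wordOf ts)) ↭ ts
  tilesOf-wordOf {ts} T = sameFerrers⇒↭ (tilesOf-isExactCover W) T λ {v} {c} → begin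
    ferrers (toℕ v) c ∈ tilesOf (lookupℕ (wordOf ts)) ∼⟨ ferrers∈tilesOf⇔ W ⟩
    lookupℕ (wordOf ts) c ≡ just v                    ≡⟨ cong (_≡ just v) (lookupℕ-tabulate _ bounded c) ⟩
    rowAt ts c ≡ just v                               ∼⟨ rowAt≡just⇔ T ⟩
    ferrers (toℕ v) c ∈ ts                            ∎
    where
    open Related.EquationalReasoning {k = Related.equivalence}
    R : IsAnchorSequence (rowAt ts)
    R = rowAt-isAnchorSequence T
    open IsAnchorSequence R using (bounded)
    W : IsAnchorSequence (lookupℕ (wordOf ts))
    W = isAnchorWord⇒isAnchorSequence (wordOf ts) (isAnchorSequence⇒isAnchorWord R)

  toTiling : Σ (Vec (Letter d) n) (IsAnchorWord μ d n) → Σ (List Tile) (IsTiling μ rows n)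
  toTiling (w , A) = tilesOf (lookupℕ w) , isExactCover⇒isTiling (tilesOf-isExactCover W)
    where
    W : IsAnchorSequence (lookupℕ w)
    W = isAnchorWord⇒isAnchorSequence w A

  toAnchorWord : Σ (List Tile) (IsTiling μ rows n) → Σ (Vec (Letter d) n) (IsAnchorWord μ d n)
  toAnchorWord (ts , T) =
    wordOf ts , isAnchorSequence⇒isAnchorWord (rowAt-isAnchorSequence (isTiling⇒isExactCover T))

proposition4p2 : (ℓ : ℕ) (μ : Fin (suc ℓ) → ℕ) → IsPartition μ →
                 (d n : ℕ) → 1 ≤ d → d ≤ μ fzero →
                 Bijection (AnchorWords μ d n) (Tilings μ d n)
proposition4p2 ℓ μ isPartition d n _ d≤μ₀ = record
  { to        = toTiling
  ; cong      = ↭-reflexive ∘ cong (tilesOf ∘ lookupℕ)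
  ; bijective = (λ {(_ , A)} {(_ , A′)} → tilesOf-injective A A′)
              , λ (ts , T) → toAnchorWord (ts , T)
                           , λ { {_ , _} refl → tilesOf-wordOf (isTiling⇒isExactCover T) }
  }
  where
  open ExactCovers μ
  open AnchorTilings μ isPartition d d≤μ₀ n
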